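{- Let $D$ be a digraph each of whose weak components has a source. Then for each integer $m \geq 2$: each weak component of $D$ is a star-generating digraph if and only if the $m$-step competition graph $C^m(D)$ is triangle-free and the number of sources of $D$ equals the number of components of $C^m(D)$. Moreover, the implication "each weak component of $D$ is star-generating $\Rightarrow$ $C^m(D)$ is triangle-free and the number of sources of $D$ equals the number of components of $C^m(D)$" also holds for $m=1$.
   Context: All digraphs are finite, may have loops, and (standing assumption) every vertex has outdegree at least $1$. For a positive integer $m$, a vertex $y$ is an $m$-step prey of $x$ if there is a directed walk of length $m$ from $x$ to $y$; $1$-step prey/predators are called prey/predators. The $m$-step competition graph $C^m(D)$ has vertex set $V(D)$ and an edge between distinct vertices $x,y$ iff they have a common $m$-step prey. A source is a vertex of indegree $0$. $D$ is weakly connected if its underlying undirected graph is connected; a weak component is the subdigraph induced by a component of the underlying graph. A weakly connected digraph $D$ is star-generating if: ($S_1$) $D$ has at least one source and, for each source $v$, each prey of $v$ has exactly two predators; ($S_2$) no two sources of $D$ have a common prey; ($S_3$) each non-source vertex has exactly one prey and exactly two predators, one of which is a source and the other of which is a non-source vertex. -}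

module Defs where

open import Data.Nat using (ℕ; zero; suc; _≤_)
open import Data.Fin using (Fin)
open import Data.Bool using (Bool; true; false; not)
open import Data.List using (List; length; filterᵇ; null; allFin)
open import Data.Product using (Σ; ∃; ∃-syntax; _×_; _,_)
open import Data.Sum using (_⊎_)
open import Data.Empty using (⊥)
open import Relation.Nullary using (¬_)
open import Relation.Binary.PropositionalEquality using (_≡_; _≢_)
open import Relation.Binary.Construct.Closure.ReflexiveTransitive using (Star)
open import Function.Definitions using (Surjective)

Digraph : ℕ → Set
Digraph n = Fin n → Fin n → Bool

Arc : ∀ {n} → Digraph n → Fin n → Fin n → Set
Arc D x y = D x y ≡ true

-- Standing assumption: every vertex has outdegree at least 1.
OutdegPos : ∀ {n} → Digraph n → Set
OutdegPos D = ∀ x → ∃[ y ] Arc D x y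

data Walk {n} (D : Digraph n) : ℕ → Fin n → Fin n → Set where
  here : ∀ {x} → Walk D zero x x
  step : ∀ {k x y z} → Arc D x y → Walk D k y z → Walk D (suc k) x z

Graph : ℕ → Set₁
Graph n = Fin n → Fin n → Set

Cm : ∀ {n} → ℕ → Digraph n → Graph n
Cm m D x y = x ≢ y × ∃[ z ] (Walk D m x z × Walk D m y z)

TriangleFree : ∀ {n} → Graph n → Set
TriangleFree G = ∀ x y z → G x y → G y z → G x z → ⊥

Connected : ∀ {n} → Graph n → Fin n → Fin n → Set
Connected G = Star G

NumComponents : ∀ {n} → Graph n → ℕ → Set
NumComponents {n} G k =
  Σ (Fin n → Fin k) λ c →
    Surjective _≡_ _≡_ c × (∀ u v → (c u ≡ c v → Connected G u v) × (Connected G u v → c u ≡ c v))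

IsSource : ∀ {n} → Digraph n → Fin n → Set
IsSource D v = ∀ u → D u v ≡ false

sourceᵇ : ∀ {n} → Digraph n → Fin n → Bool
sourceᵇ {n} D v = null (filterᵇ (λ u → D u v) (allFin n))

numSources : ∀ {n} → Digraph n → ℕ
numSources {n} D = length (filterᵇ (sourceᵇ D) (allFin n))

WConn : ∀ {n} → Digraph n → Fin n → Fin n → Set
WConn D = Star (λ a b → Arc D a b ⊎ Arc D b a)

EachWeakCompHasSource : ∀ {n} → Digraph n → Set
EachWeakCompHasSource D = ∀ v → ∃[ s ] (WConn D v s × IsSource D s)

module _ {n} (D : Digraph n) (P : Fin n → Set) where

  ArcP : Fin n → Fin n → Set
  ArcP x y = P x × P y × Arc D x y

  SourceP : Fin n → Set
  SourceP v = P v × (∀ u → P u → ¬ Arc D u v)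

  NonSourceP : Fin n → Set
  NonSourceP v = P v × ¬ (∀ u → P u → ¬ Arc D u v)

  WeaklyConnectedP : Set
  WeaklyConnectedP = ∀ x y → P x → P y → Star (λ a b → ArcP a b ⊎ ArcP b a) x y

  TwoPredators : Fin n → Set
  TwoPredators w = ∃[ a ] ∃[ b ] (a ≢ b × ArcP a w × ArcP b w × (∀ c → ArcP c w → c ≡ a ⊎ c ≡ b))

  TwoPredatorsSrcNonSrc : Fin n → Set
  TwoPredatorsSrcNonSrc w =
    ∃[ a ] ∃[ b ] (a ≢ b × ArcP a w × ArcP b w × (∀ c → ArcP c w → c ≡ a ⊎ c ≡ b)
                   × SourceP a × NonSourceP b)

  OnePrey : Fin n → Set
  OnePrey x = ∃[ y ] (ArcP x y × (∀ z → ArcP x z → z ≡ y))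

  S₁ : Set
  S₁ = (∃[ v ] SourceP v) × (∀ v w → SourceP v → ArcP v w → TwoPredators w)

  S₂ : Set
  S₂ = ∀ u v w → SourceP u → SourceP v → u ≢ v → ArcP u w → ArcP v w → ⊥

  S₃ : Set
  S₃ = ∀ x → NonSourceP x → OnePrey x × TwoPredatorsSrcNonSrc x

  StarGeneratingP : Set
  StarGeneratingP = WeaklyConnectedP × S₁ × S₂ × S₃

AllWeakCompsStarGen : ∀ {n} → Digraph n → Set
AllWeakCompsStarGen D = ∀ v → StarGeneratingP D (WConn D v)

module Submission where

-- Both sides of the equivalence amount to condition (S₃) for D as a whole: every
-- non-source has exactly one prey and exactly two predators, a source and a non-source.
--
-- Under (S₃), walks of equal length from two non-sources, or from two sources, to a
-- common vertex start at the same vertex.  So every edge of C^m(D) joins a source and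
-- a non-source (whence triangle-freeness), and the components of C^m(D) are the stars
-- formed by each source s and the vertices sharing a prey with s.
--
-- Conversely, let C^m(D) be triangle-free with as many components as D has sources,
-- and fix a spanning forest of it.  Sending each root to a source and each other vertex
-- to an m-step prey it shares with its parent is injective, since triangle-freeness
-- leaves every vertex at most two m-step predators and the forest has no 2-cycles.  So
-- this map is onto: every non-source has exactly two m-step predators, and distinct
-- non-sources have distinct pairs.  For m ≥ 2 this lets one choose for each
-- non-source y a non-source predator injectively, every other non-source predator of y
-- being the forest parent of the chosen one; a non-source with two prey would then yield
-- another one closer to the roots, so none exists, and (S₃) follows.

open import Defs
open import Data.Nat using (ℕ; zero; suc; _≤_; _<_; s≤s)
open import Data.Nat.Properties using (≤-refl; ≤-trans; <-irrefl; <-asym; n<1+n; m<1+n⇒m<n∨m≡n; ≮⇒≥)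
open import Data.Nat.Induction using (<-wellFounded)
open import Induction.WellFounded using (Acc; acc)
open import Data.Fin using (Fin; zero; suc; _≟_; punchOut)
open import Data.Fin.Properties using (any?; punchOut-injective; injective⇒≤)
open import Data.Bool using (true; T)
open import Data.Bool.Properties using (T-≡) renaming (_≟_ to _≟ᵇ_)
open import Data.Unit using (tt)
open import Data.List using (List; []; _∷_; lookup; filterᵇ; null; allFin)
open import Data.List.Properties using (filter-none)
open import Data.List.Membership.Propositional using (_∈_)
open import Data.List.Membership.Propositional.Properties using (∈-allFin; ∈-lookup; ∈-filter⁺; ∈-filter⁻)
open import Data.List.Relation.Unary.Any using (index)
open import Data.List.Relation.Unary.Any.Properties using (lookup-index)
import Data.List.Relation.Unary.All as All
open import Data.List.Relation.Unary.AllPairs using (_∷_)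
open import Data.List.Relation.Unary.Unique.Propositional using (Unique)
open import Data.List.Relation.Unary.Unique.Propositional.Properties using (allFin⁺; filter⁺)
open import Data.Product using (Σ; ∃; ∃-syntax; _×_; _,_; proj₁; proj₂)
open import Data.Sum using (_⊎_; inj₁; inj₂; map₂; swap)
open import Data.Empty using (⊥; ⊥-elim; ⊥-elim-irr)
open import Function using (_∘_)
open import Function.Bundles using (Equivalence; _⇔_; mk⇔)
open import Function.Definitions using (Injective)
open import Relation.Nullary using (¬_; Dec; yes; no)
open import Relation.Nullary.Decidable using (T?; _×-dec_; _⊎-dec_)
open import Relation.Binary.PropositionalEquality using (_≡_; _≢_; refl; sym; trans; cong; subst)
open import Relation.Binary.Construct.Closure.ReflexiveTransitive using (Star; ε; _◅_; _◅◅_; fold; reverse)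

injective⇒surjective : ∀ {m n} {f : Fin m → Fin n} → n ≤ m → Injective _≡_ _≡_ f →
                       ∀ y → ∃ λ x → f x ≡ y
injective⇒surjective {m} {suc n} {f} n≤m f-injective y with any? (λ x → f x ≟ y)
... | yes found = found
... | no missed = ⊥-elim (<-irrefl refl (≤-trans n≤m (injective⇒≤ g-injective)))
  where
  g : Fin m → Fin n
  g x = punchOut {i = y} {j = f x} (λ y≡fx → missed (x , sym y≡fx))

  g-injective : Injective _≡_ _≡_ g
  g-injective = f-injective ∘ punchOut-injective {i = y} _ _

Minimal : (ℕ → Set) → ℕ → Set
Minimal P d = P d × (∀ {d′} → d′ < d → ¬ P d′)

module _ {P : ℕ → Set} (P? : ∀ d → Dec (P d)) where

  private
    searchBelow : ∀ b → ∃ (Minimal P) ⊎ (∀ {d} → d < b → ¬ P d)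
    searchBelow zero = inj₂ λ ()
    searchBelow (suc b) with searchBelow b
    ... | inj₁ found = inj₁ found
    ... | inj₂ none with P? b
    ...   | yes pb = inj₁ (b , pb , none)
    ...   | no ¬pb = inj₂ λ d<1+b → below (m<1+n⇒m<n∨m≡n d<1+b)
      where
      below : ∀ {d} → d < b ⊎ d ≡ b → ¬ P d
      below (inj₁ d<b) = none d<b
      below (inj₂ refl) = ¬pb

  least-witness : ∃ P → ∃ (Minimal P)
  least-witness (d , pd) with searchBelow (suc d)
  ... | inj₁ found = found
  ... | inj₂ none = ⊥-elim (none (n<1+n d) pd)

lookup-injective : ∀ {A : Set} {xs : List A} → Unique xs → Injective _≡_ _≡_ (lookup xs)
lookup-injective (x∉xs ∷ _) {zero} {zero} _ = refl
lookup-injective (x∉xs ∷ _) {zero} {suc j} x≡xⱼ = ⊥-elim (All.lookup x∉xs (∈-lookup j) x≡xⱼ)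
lookup-injective (x∉xs ∷ _) {suc i} {zero} xᵢ≡x = ⊥-elim (All.lookup x∉xs (∈-lookup i) (sym xᵢ≡x))
lookup-injective (_ ∷ unique) {suc i} {suc j} xᵢ≡xⱼ = cong suc (lookup-injective unique xᵢ≡xⱼ)

∈⇒¬null : ∀ {A : Set} {x : A} {xs} → x ∈ xs → ¬ T (null xs)
∈⇒¬null {xs = _ ∷ _} _ ()

HasPredator : ∀ {n} → Digraph n → Fin n → Set
HasPredator D x = ∃[ u ] Arc D u x

module _ {n} (D : Digraph n) where

  arc? : ∀ x y → Dec (Arc D x y)
  arc? x y = D x y ≟ᵇ true

  hasPredator? : ∀ x → Dec (HasPredator D x)
  hasPredator? x = any? (λ u → arc? u x)

  walk? : ∀ k x z → Dec (Walk D k x z)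
  walk? zero x z with x ≟ z
  ... | yes refl = yes here
  ... | no x≢z = no λ { here → x≢z refl }
  walk? (suc k) x z with any? (λ y → arc? x y ×-dec walk? k y z)
  ... | yes (_ , x→y , y⇝z) = yes (step x→y y⇝z)
  ... | no none = no λ { (step x→y y⇝z) → none (_ , x→y , y⇝z) }

  competes? : ∀ k x y → Dec (Cm k D x y)
  competes? k x y with x ≟ y
  ... | yes x≡y = no λ c → proj₁ c x≡y
  ... | no x≢y with any? (λ z → walk? k x z ×-dec walk? k y z)
  ...   | yes prey = yes (x≢y , prey)
  ...   | no none = no λ c → none (proj₂ c)

  isSource⇒¬predator : ∀ {s} → IsSource D s → ¬ HasPredator D s
  isSource⇒¬predator source (u , u→s) with trans (sym u→s) (source u)
  ... | ()

  sourceᵇ⇒¬predator : ∀ {s} → T (sourceᵇ D s) → ¬ HasPredator D s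
  sourceᵇ⇒¬predator {s} noPredators (u , u→s) =
    ∈⇒¬null (∈-filter⁺ (T? ∘ λ v → D v s) (∈-allFin u) (Equivalence.from T-≡ u→s)) noPredators

  ¬predator⇒sourceᵇ : ∀ {s} → ¬ HasPredator D s → T (sourceᵇ D s)
  ¬predator⇒sourceᵇ {s} ¬hs = subst (T ∘ null) (sym noPredators) tt
    where
    noPredators : filterᵇ (λ v → D v s) (allFin n) ≡ []
    noPredators = filter-none (T? ∘ λ v → D v s)
                    (All.universal (λ u u→s → ¬hs (u , Equivalence.to T-≡ u→s)) (allFin n))

module _ {n} {D : Digraph n} where

  _▷_ : ∀ {k x y z} → Walk D k x y → Arc D y z → Walk D (suc k) x z
  here ▷ y→z = step y→z here
  step x→w w⇝y ▷ y→z = step x→w (w⇝y ▷ y→z)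

  unsnoc : ∀ {k x z} → Walk D (suc k) x z → ∃ λ y → Walk D k x y × Arc D y z
  unsnoc (step x→z here) = _ , here , x→z
  unsnoc (step x→w w⇝z@(step _ _)) with unsnoc w⇝z
  ... | y , w⇝y , y→z = y , step x→w w⇝y , y→z

  walk⇒predator : ∀ {k x z} → Walk D (suc k) x z → HasPredator D z
  walk⇒predator x⇝z with unsnoc x⇝z
  ... | y , _ , y→z = y , y→z

  predator-walk : ∀ {k x z} → HasPredator D x → Walk D k x z → HasPredator D z
  predator-walk hx here = hx
  predator-walk _ (step x→y y⇝z) = predator-walk (_ , x→y) y⇝z

  walkFrom : OutdegPos D → ∀ k x → ∃ λ z → Walk D k x z
  walkFrom outdeg zero x = x , here
  walkFrom outdeg (suc k) x with outdeg x
  ... | y , x→y with walkFrom outdeg k y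
  ...   | z , y⇝z = z , step x→y y⇝z

  anotherPrey : ∀ {x y₁ y₂} → y₁ ≢ y₂ → Arc D x y₁ → Arc D x y₂ → ∀ y → ∃[ y′ ] (y ≢ y′ × Arc D x y′)
  anotherPrey {y₁ = y₁} {y₂} y₁≢y₂ x→y₁ x→y₂ y with y₁ ≟ y
  ... | yes refl = y₂ , y₁≢y₂ , x→y₂
  ... | no y₁≢y = y₁ , y₁≢y ∘ sym , x→y₁

  competes-sym : ∀ {k x y} → Cm k D x y → Cm k D y x
  competes-sym (x≢y , z , x⇝z , y⇝z) = x≢y ∘ sym , z , y⇝z , x⇝z

module SourceEnumeration {n} (D : Digraph n) where

  sources : List (Fin n)
  sources = filterᵇ (sourceᵇ D) (allFin n)

  source : Fin (numSources D) → Fin n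
  source = lookup sources

  source-¬predator : ∀ i → ¬ HasPredator D (source i)
  source-¬predator i =
    sourceᵇ⇒¬predator D (proj₂ (∈-filter⁻ (T? ∘ sourceᵇ D) {xs = allFin n} (∈-lookup i)))

  source-injective : Injective _≡_ _≡_ source
  source-injective = lookup-injective (filter⁺ (T? ∘ sourceᵇ D) (allFin⁺ n))

  position : ∀ {s} → ¬ HasPredator D s → Fin (numSources D)
  position {s} ¬hs = index (∈-filter⁺ (T? ∘ sourceᵇ D) (∈-allFin s) (¬predator⇒sourceᵇ D ¬hs))

  source-position : ∀ {s} (¬hs : ¬ HasPredator D s) → source (position ¬hs) ≡ s
  source-position {s} ¬hs =
    sym (lookup-index (∈-filter⁺ (T? ∘ sourceᵇ D) (∈-allFin s) (¬predator⇒sourceᵇ D ¬hs)))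

module _ {n} {D : Digraph n} {k} (triangleFree : TriangleFree (Cm k D)) where

  triangleFree⇒≤2-predators : ∀ {a b c z} → a ≢ b → a ≢ c →
                              Walk D k a z → Walk D k b z → Walk D k c z → b ≡ c
  triangleFree⇒≤2-predators {b = b} {c} a≢b a≢c a⇝z b⇝z c⇝z with b ≟ c
  ... | yes b≡c = b≡c
  ... | no b≢c = ⊥-elim (triangleFree _ _ _ (a≢b , _ , a⇝z , b⇝z) (b≢c , _ , b⇝z , c⇝z) (a≢c , _ , a⇝z , c⇝z))

  triangleFree⇒samePair : ∀ {x y a b z} → x ≢ y → a ≢ b →
                          Walk D k x z → Walk D k y z → Walk D k a z → Walk D k b z →
                          (x ≡ a × y ≡ b) ⊎ (x ≡ b × y ≡ a)
  triangleFree⇒samePair {x} {y} {a} x≢y a≢b x⇝z y⇝z a⇝z b⇝z with x ≟ a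
  ... | yes refl = inj₁ (refl , triangleFree⇒≤2-predators x≢y a≢b a⇝z y⇝z b⇝z)
  ... | no x≢a with triangleFree⇒≤2-predators (x≢a ∘ sym) a≢b a⇝z x⇝z b⇝z
  ...   | refl = inj₂ (refl , triangleFree⇒≤2-predators x≢y (a≢b ∘ sym) b⇝z y⇝z a⇝z)

module SpanningForest {n} {G : Fin n → Fin n → Set} (G? : ∀ x y → Dec (G x y))
  (root : Fin n → Fin n) (toRoot : ∀ v → Star G v (root v))
  (root-resp : ∀ {u v} → G u v → root u ≡ root v) where

  Within : ℕ → Fin n → Fin n → Set
  Within zero a b = a ≡ b
  Within (suc d) a b = a ≡ b ⊎ ∃[ x ] (G a x × Within d x b)

  within? : ∀ d a b → Dec (Within d a b)
  within? zero a b = a ≟ b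
  within? (suc d) a b = a ≟ b ⊎-dec any? (λ x → G? a x ×-dec within? d x b)

  star⇒within : ∀ {a b} → Star G a b → ∃ λ d → Within d a b
  star⇒within ε = zero , refl
  star⇒within (g ◅ path) with star⇒within path
  ... | d , within = suc d , inj₂ (_ , g , within)

  depthWitness : ∀ v → ∃ (Minimal λ d → Within d v (root v))
  depthWitness v = least-witness (λ d → within? d v (root v)) (star⇒within (toRoot v))

  depth : Fin n → ℕ
  depth v = proj₁ (depthWitness v)

  depth-minimal : ∀ {v d} → Within d v (root v) → depth v ≤ d
  depth-minimal {v} within = ≮⇒≥ λ d<depth → proj₂ (proj₂ (depthWitness v)) d<depth within

  towardsRoot : ∀ v → v ≢ root v → ∃[ x ] (G v x × depth x < depth v)
  towardsRoot v v≢root with depthWitness v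
  ... | zero , v≡root , _ = ⊥-elim (v≢root v≡root)
  ... | suc d , inj₁ v≡root , _ = ⊥-elim (v≢root v≡root)
  ... | suc d , inj₂ (x , g , within) , _ =
    x , g , s≤s (depth-minimal (subst (Within d x) (root-resp g) within))

  parent : Fin n → Fin n
  parent v with v ≟ root v
  ... | yes _ = v
  ... | no v≢root = proj₁ (towardsRoot v v≢root)

  -- The hypothesis v ≢ root v is irrelevant, so that data extracted from the edge to
  -- the parent does not depend on its proof.
  parent-spec : ∀ {v} → .(v ≢ root v) → G v (parent v) × depth (parent v) < depth v
  parent-spec {v} v≢root with v ≟ root v
  ... | yes v≡root = ⊥-elim-irr (v≢root v≡root)
  ... | no v≢root′ = proj₂ (towardsRoot v v≢root′)

  parent-edge : ∀ {v} → .(v ≢ root v) → G v (parent v)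
  parent-edge v≢root = proj₁ (parent-spec v≢root)

  depth-parent : ∀ {v} → .(v ≢ root v) → depth (parent v) < depth v
  depth-parent v≢root = proj₂ (parent-spec v≢root)

  parent-acyclic : ∀ {v w} → v ≢ root v → w ≢ root w → parent v ≡ w → parent w ≡ v → ⊥
  parent-acyclic {v} {w} v≢root w≢root pv≡w pw≡v =
    <-asym (subst (λ x → depth x < depth v) pv≡w (depth-parent v≢root))
           (subst (λ x → depth x < depth w) pw≡v (depth-parent w≢root))

record PredatorPair {n} (D : Digraph n) (x : Fin n) : Set where
  field
    src nonSrc : Fin n
    src→x : Arc D src x
    nonSrc→x : Arc D nonSrc x
    onlyPredators : ∀ {c} → Arc D c x → c ≡ src ⊎ c ≡ nonSrc
    src-¬predator : ¬ HasPredator D src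
    nonSrc-predator : HasPredator D nonSrc

  src≢nonSrc : src ≢ nonSrc
  src≢nonSrc src≡nonSrc = src-¬predator (subst (HasPredator D) (sym src≡nonSrc) nonSrc-predator)

-- Condition (S₃) for D as a whole; (S₁) and (S₂) follow once each weak component has a source.
record GlobalS₃ {n} (D : Digraph n) : Set where
  field
    uniquePrey : ∀ {x} → HasPredator D x → ∃[ y ] (Arc D x y × (∀ {z} → Arc D x z → z ≡ y))
    predatorPair : ∀ {x} → HasPredator D x → PredatorPair D x

module GlobalS₃Properties {n} {D : Digraph n} (S : GlobalS₃ D) where

  open GlobalS₃ S public
  open PredatorPair

  nonSourcePredator-unique : ∀ {x x′ y} → Arc D x y → Arc D x′ y →
                             HasPredator D x → HasPredator D x′ → x ≡ x′
  nonSourcePredator-unique {y = y} x→y x′→y hx hx′ = trans (≡nonSrc x→y hx) (sym (≡nonSrc x′→y hx′))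
    where
    P = predatorPair (_ , x→y)

    ≡nonSrc : ∀ {c} → Arc D c y → HasPredator D c → c ≡ nonSrc P
    ≡nonSrc c→y hc with onlyPredators P c→y
    ... | inj₁ refl = ⊥-elim (src-¬predator P hc)
    ... | inj₂ c≡nonSrc = c≡nonSrc

  sourcePredator-unique : ∀ {s s′ y} → Arc D s y → Arc D s′ y →
                          ¬ HasPredator D s → ¬ HasPredator D s′ → s ≡ s′
  sourcePredator-unique {y = y} s→y s′→y ¬hs ¬hs′ = trans (≡src s→y ¬hs) (sym (≡src s′→y ¬hs′))
    where
    P = predatorPair (_ , s→y)

    ≡src : ∀ {c} → Arc D c y → ¬ HasPredator D c → c ≡ src P
    ≡src c→y ¬hc with onlyPredators P c→y
    ... | inj₁ c≡src = c≡src
    ... | inj₂ refl = ⊥-elim (¬hc (nonSrc-predator P))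

module _ {n} {D : Digraph n} where

  open PredatorPair

  predator∈component : ∀ {v a u} → WConn D v a → Arc D u a → WConn D v u
  predator∈component v~a u→a = v~a ◅◅ (inj₂ u→a ◅ ε)

  prey∈component : ∀ {v a u} → WConn D v a → Arc D a u → WConn D v u
  prey∈component v~a a→u = v~a ◅◅ (inj₁ a→u ◅ ε)

  sourceP⇒¬predator : ∀ {v u} → SourceP D (WConn D v) u → ¬ HasPredator D u
  sourceP⇒¬predator (v~u , noPredatorP) (w , w→u) = noPredatorP w (predator∈component v~u w→u) w→u

  nonSourceP⇒predator : ∀ {v u} → NonSourceP D (WConn D v) u → HasPredator D u
  nonSourceP⇒predator {u = u} (_ , hasPredatorP) with hasPredator? D u
  ... | yes hu = hu
  ... | no ¬hu = ⊥-elim (hasPredatorP λ w _ w→u → ¬hu (w , w→u))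

  ¬predator⇒sourceP : ∀ {v u} → WConn D v u → ¬ HasPredator D u → SourceP D (WConn D v) u
  ¬predator⇒sourceP v~u ¬hu = v~u , λ w _ w→u → ¬hu (w , w→u)

  predator⇒nonSourceP : ∀ {v u} → WConn D v u → HasPredator D u → NonSourceP D (WConn D v) u
  predator⇒nonSourceP v~u (w , w→u) = v~u , λ noPredatorP → noPredatorP w (predator∈component v~u w→u) w→u

  allWeakCompsStarGen⇒globalS₃ : AllWeakCompsStarGen D → GlobalS₃ D
  allWeakCompsStarGen⇒globalS₃ starGen = record { uniquePrey = uniquePrey ; predatorPair = predatorPair }
    where
    s₃ : ∀ {x} → HasPredator D x → OnePrey D (WConn D x) x × TwoPredatorsSrcNonSrc D (WConn D x) x
    s₃ {x} hx = proj₂ (proj₂ (proj₂ (starGen x))) x (predator⇒nonSourceP ε hx)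

    uniquePrey : ∀ {x} → HasPredator D x → ∃[ y ] (Arc D x y × (∀ {z} → Arc D x z → z ≡ y))
    uniquePrey hx with proj₁ (s₃ hx)
    ... | y , (_ , _ , x→y) , onlyPrey = y , x→y , λ x→z → onlyPrey _ (ε , prey∈component ε x→z , x→z)

    predatorPair : ∀ {x} → HasPredator D x → PredatorPair D x
    predatorPair hx with proj₂ (s₃ hx)
    ... | a , b , _ , (_ , _ , a→x) , (_ , _ , b→x) , only , sourceA , nonSourceB = record
      { src = a ; nonSrc = b ; src→x = a→x ; nonSrc→x = b→x
      ; onlyPredators = λ c→x → only _ (predator∈component ε c→x , ε , c→x)
      ; src-¬predator = sourceP⇒¬predator sourceA
      ; nonSrc-predator = nonSourceP⇒predator nonSourceB
      }

  globalS₃⇒allWeakCompsStarGen : GlobalS₃ D → EachWeakCompHasSource D → AllWeakCompsStarGen D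
  globalS₃⇒allWeakCompsStarGen S hasSource v = weaklyConnected , (s₁-source , s₁-prey) , s₂ , s₃
    where
    open GlobalS₃Properties S

    P : Fin n → Set
    P = WConn D v

    EdgeP : Fin n → Fin n → Set
    EdgeP a b = ArcP D P a b ⊎ ArcP D P b a

    lift : ∀ {a b} → P a → WConn D a b → Star EdgeP a b
    lift pa ε = ε
    lift pa (inj₁ a→c ◅ c~b) = inj₁ (pa , pc , a→c) ◅ lift pc c~b
      where pc = prey∈component pa a→c
    lift pa (inj₂ c→a ◅ c~b) = inj₂ (pc , pa , c→a) ◅ lift pc c~b
      where pc = predator∈component pa c→a

    weaklyConnected : WeaklyConnectedP D P
    weaklyConnected x y px py = reverse swap (lift ε px) ◅◅ lift ε py

    predatorsP : ∀ {x} → P x → HasPredator D x → TwoPredatorsSrcNonSrc D P x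
    predatorsP px hx =
      src Q , nonSrc Q , src≢nonSrc Q ,
      (predator∈component px (src→x Q) , px , src→x Q) ,
      (predator∈component px (nonSrc→x Q) , px , nonSrc→x Q) ,
      (λ c c→x → onlyPredators Q (proj₂ (proj₂ c→x))) ,
      ¬predator⇒sourceP (predator∈component px (src→x Q)) (src-¬predator Q) ,
      predator⇒nonSourceP (predator∈component px (nonSrc→x Q)) (nonSrc-predator Q)
      where
      Q = predatorPair hx

    s₁-source : ∃[ s ] SourceP D P s
    s₁-source with hasSource v
    ... | s , v~s , sourceS = s , ¬predator⇒sourceP v~s (isSource⇒¬predator D sourceS)

    s₁-prey : ∀ u w → SourceP D P u → ArcP D P u w → TwoPredators D P w
    s₁-prey u w _ (_ , pw , u→w) with predatorsP pw (u , u→w)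
    ... | a , b , a≢b , a→w , b→w , only , _ = a , b , a≢b , a→w , b→w , only

    s₂ : S₂ D P
    s₂ u u′ w sourceU sourceU′ u≢u′ (_ , _ , u→w) (_ , _ , u′→w) =
      u≢u′ (sourcePredator-unique u→w u′→w (sourceP⇒¬predator sourceU) (sourceP⇒¬predator sourceU′))

    s₃ : S₃ D P
    s₃ x nonSourceX@(px , _) = onePrey , predatorsP px hx
      where
      hx = nonSourceP⇒predator nonSourceX

      onePrey : OnePrey D P x
      onePrey with uniquePrey hx
      ... | y , x→y , onlyPrey = y , (px , prey∈component px x→y , x→y) , λ z x→z → onlyPrey (proj₂ (proj₂ x→z))

module GlobalS₃⇒StepCompetition {n} {D : Digraph n} (outdeg : OutdegPos D) (S : GlobalS₃ D) (m′ : ℕ) where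

  open GlobalS₃Properties S
  open PredatorPair
  open SourceEnumeration D

  m : ℕ
  m = suc m′

  nonSource-walks-injective : ∀ j {x x′ z} → HasPredator D x → HasPredator D x′ →
                              Walk D j x z → Walk D j x′ z → x ≡ x′
  nonSource-walks-injective zero _ _ here here = refl
  nonSource-walks-injective (suc j) hx hx′ (step x→y y⇝z) (step x′→y′ y′⇝z)
    with nonSource-walks-injective j (_ , x→y) (_ , x′→y′) y⇝z y′⇝z
  ... | refl = nonSourcePredator-unique x→y x′→y′ hx hx′

  source-walks-injective : ∀ j {s s′ z} → ¬ HasPredator D s → ¬ HasPredator D s′ →
                           Walk D (suc j) s z → Walk D (suc j) s′ z → s ≡ s′
  source-walks-injective j ¬hs ¬hs′ (step s→y y⇝z) (step s′→y′ y′⇝z)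
    with nonSource-walks-injective j (_ , s→y) (_ , s′→y′) y⇝z y′⇝z
  ... | refl = sourcePredator-unique s→y s′→y′ ¬hs ¬hs′

  nonSources-nonadjacent : ∀ {x y} → HasPredator D x → HasPredator D y → ¬ Cm m D x y
  nonSources-nonadjacent hx hy (x≢y , _ , x⇝z , y⇝z) = x≢y (nonSource-walks-injective m hx hy x⇝z y⇝z)

  sources-nonadjacent : ∀ {x y} → ¬ HasPredator D x → ¬ HasPredator D y → ¬ Cm m D x y
  sources-nonadjacent ¬hx ¬hy (x≢y , _ , x⇝z , y⇝z) = x≢y (source-walks-injective m′ ¬hx ¬hy x⇝z y⇝z)

  triangleFree : TriangleFree (Cm m D)
  triangleFree x y z xy yz xz with hasPredator? D x | hasPredator? D y | hasPredator? D z
  ... | yes hx | yes hy | _      = nonSources-nonadjacent hx hy xy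
  ... | no ¬hx | no ¬hy | _      = sources-nonadjacent ¬hx ¬hy xy
  ... | yes hx | no _   | yes hz = nonSources-nonadjacent hx hz xz
  ... | yes _  | no ¬hy | no ¬hz = sources-nonadjacent ¬hy ¬hz yz
  ... | no _   | yes hy | yes hz = nonSources-nonadjacent hy hz yz
  ... | no ¬hx | yes _  | no ¬hz = sources-nonadjacent ¬hx ¬hz xz

  Centre : Fin n → Fin n → Set
  Centre x s = ¬ HasPredator D s × ∃[ y ] (Arc D x y × Arc D s y)

  centre-exists : ∀ x → ∃ (Centre x)
  centre-exists x with hasPredator? D x
  ... | no ¬hx = x , ¬hx , proj₁ (outdeg x) , proj₂ (outdeg x) , proj₂ (outdeg x)
  ... | yes hx with uniquePrey hx
  ...   | y , x→y , _ = src P , src-¬predator P , y , x→y , src→x P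
    where
    P = predatorPair (x , x→y)

  centre-unique : ∀ {x s s′} → Centre x s → Centre x s′ → s ≡ s′
  centre-unique {x} (¬hs , y , x→y , s→y) (¬hs′ , y′ , x→y′ , s′→y′) with hasPredator? D x
  ... | yes hx with uniquePrey hx
  ...   | _ , _ , onlyPrey with trans (onlyPrey x→y) (sym (onlyPrey x→y′))
  ...     | refl = sourcePredator-unique s→y s′→y′ ¬hs ¬hs′
  centre-unique {x} (¬hs , y , x→y , s→y) (¬hs′ , y′ , x→y′ , s′→y′) | no ¬hx =
    trans (sourcePredator-unique s→y x→y ¬hs ¬hx) (sourcePredator-unique x→y′ s′→y′ ¬hx ¬hs′)

  centre : Fin n → Fin n
  centre x = proj₁ (centre-exists x)

  centre-¬predator : ∀ x → ¬ HasPredator D (centre x)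
  centre-¬predator x = proj₁ (proj₂ (centre-exists x))

  centre-source : ∀ {s} → ¬ HasPredator D s → centre s ≡ s
  centre-source {s} ¬hs =
    centre-unique (proj₂ (centre-exists s)) (¬hs , proj₁ (outdeg s) , proj₂ (outdeg s) , proj₂ (outdeg s))

  adjacent⇒centre : ∀ {x s} → HasPredator D x → ¬ HasPredator D s → Cm m D x s → centre x ≡ s
  adjacent⇒centre hx ¬hs (_ , _ , step x→y y⇝z , step s→y′ y′⇝z)
    with nonSource-walks-injective m′ (_ , x→y) (_ , s→y′) y⇝z y′⇝z
  ... | refl = centre-unique (proj₂ (centre-exists _)) (¬hs , _ , x→y , s→y′)

  centre-resp : ∀ {x y} → Cm m D x y → centre x ≡ centre y
  centre-resp {x} {y} xy = byKinds (hasPredator? D x) (hasPredator? D y)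
    where
    byKinds : Dec (HasPredator D x) → Dec (HasPredator D y) → centre x ≡ centre y
    byKinds (yes hx) (yes hy) = ⊥-elim (nonSources-nonadjacent hx hy xy)
    byKinds (no ¬hx) (no ¬hy) = ⊥-elim (sources-nonadjacent ¬hx ¬hy xy)
    byKinds (yes hx) (no ¬hy) = trans (adjacent⇒centre hx ¬hy xy) (sym (centre-source ¬hy))
    byKinds (no ¬hx) (yes hy) = trans (centre-source ¬hx) (sym (adjacent⇒centre hy ¬hx (competes-sym xy)))

  toCentre : ∀ x → Star (Cm m D) x (centre x)
  toCentre x with x ≟ centre x | proj₂ (proj₂ (centre-exists x))
  ... | yes x≡s | _ = subst (Star (Cm m D) x) x≡s ε
  ... | no x≢s | y , x→y , s→y = (x≢s , _ , step x→y y⇝ , step s→y y⇝) ◅ ε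
    where
    y⇝ = proj₂ (walkFrom outdeg m′ y)

  label : Fin n → Fin (numSources D)
  label x = position (centre-¬predator x)

  label≡⇒centre≡ : ∀ {x y} → label x ≡ label y → centre x ≡ centre y
  label≡⇒centre≡ {x} {y} e = trans (sym (source-position (centre-¬predator x)))
                                    (trans (cong source e) (source-position (centre-¬predator y)))

  centre≡⇒label≡ : ∀ {x y} → centre x ≡ centre y → label x ≡ label y
  centre≡⇒label≡ {x} {y} e = source-injective (trans (source-position (centre-¬predator x))
                                                     (trans e (sym (source-position (centre-¬predator y)))))

  numComponents : NumComponents (Cm m D) (numSources D)
  numComponents = label , surjective , λ u v → connected u v , labelled
    where
    surjective : ∀ i → ∃ λ x → ∀ {z} → z ≡ x → label z ≡ i
    surjective i = source i , λ { refl → source-injective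
      (trans (source-position (centre-¬predator (source i))) (centre-source (source-¬predator i))) }

    connected : ∀ u v → label u ≡ label v → Star (Cm m D) u v
    connected u v e = toCentre u ◅◅
      subst (λ s → Star (Cm m D) s v) (sym (label≡⇒centre≡ e)) (reverse competes-sym (toCentre v))

    labelled : ∀ {u v} → Star (Cm m D) u v → label u ≡ label v
    labelled = fold (λ u v → label u ≡ label v) (λ uv e → trans (centre≡⇒label≡ (centre-resp uv)) e) refl

module StepCompetition⇒GlobalS₃ {n} {D : Digraph n} (outdeg : OutdegPos D) (m′ : ℕ)
  (triangleFree : TriangleFree (Cm (suc (suc m′)) D))
  (components : NumComponents (Cm (suc (suc m′)) D) (numSources D)) where

  open SourceEnumeration D

  m : ℕ
  m = suc (suc m′)

  label : Fin n → Fin (numSources D)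
  label = proj₁ components

  representative : Fin (numSources D) → Fin n
  representative i = proj₁ (proj₁ (proj₂ components) i)

  root : Fin n → Fin n
  root v = representative (label v)

  label-root : ∀ v → label (root v) ≡ label v
  label-root v = proj₂ (proj₁ (proj₂ components) (label v)) refl

  open SpanningForest (competes? D m) root
    (λ v → proj₁ (proj₂ (proj₂ components) v (root v)) (sym (label-root v)))
    (λ {u} {v} uv → cong representative (proj₂ (proj₂ (proj₂ components) u v) (uv ◅ ε)))

  ≢parent : ∀ {v} → .(v ≢ root v) → v ≢ parent v
  ≢parent v≢root = proj₁ (parent-edge v≢root)

  sharedPrey : ∀ {v} → .(v ≢ root v) → Fin n
  sharedPrey v≢root = proj₁ (proj₂ (parent-edge v≢root))

  sharedPrey-walks : ∀ {v} .(v≢root : v ≢ root v) →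
                     Walk D m v (sharedPrey v≢root) × Walk D m (parent v) (sharedPrey v≢root)
  sharedPrey-walks v≢root = proj₂ (proj₂ (parent-edge v≢root))

  sharedPrey-predator : ∀ {v} .(v≢root : v ≢ root v) → HasPredator D (sharedPrey v≢root)
  sharedPrey-predator v≢root = walk⇒predator (proj₁ (sharedPrey-walks v≢root))

  parent-unique : ∀ {v w} (v≢root : v ≢ root v) → v ≢ w → Walk D m w (sharedPrey v≢root) → parent v ≡ w
  parent-unique v≢root v≢w w⇝ = triangleFree⇒≤2-predators triangleFree (≢parent v≢root) v≢w
    (proj₁ (sharedPrey-walks v≢root)) (proj₂ (sharedPrey-walks v≢root)) w⇝

  sharedPrey-injective : ∀ {v w} (v≢root : v ≢ root v) (w≢root : w ≢ root w) →
                         sharedPrey v≢root ≡ sharedPrey w≢root → v ≡ w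
  sharedPrey-injective {v} {w} v≢root w≢root e with v ≟ w
  ... | yes v≡w = v≡w
  ... | no v≢w = ⊥-elim (parent-acyclic v≢root w≢root
    (parent-unique v≢root v≢w (subst (Walk D m w) (sym e) (proj₁ (sharedPrey-walks w≢root))))
    (parent-unique w≢root (v≢w ∘ sym) (subst (Walk D m v) e (proj₁ (sharedPrey-walks v≢root)))))

  encode : Fin n → Fin n
  encode v with v ≟ root v
  ... | yes _ = source (label v)
  ... | no v≢root = sharedPrey v≢root

  encode-injective : Injective _≡_ _≡_ encode
  encode-injective {v} {w} e with v ≟ root v | w ≟ root w
  ... | yes v≡root | yes w≡root = trans v≡root (trans (cong representative (source-injective e)) (sym w≡root))
  ... | yes _ | no w≢root =
    ⊥-elim (source-¬predator (label v) (subst (HasPredator D) (sym e) (sharedPrey-predator w≢root)))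
  ... | no v≢root | yes _ =
    ⊥-elim (source-¬predator (label w) (subst (HasPredator D) e (sharedPrey-predator v≢root)))
  ... | no v≢root | no w≢root = sharedPrey-injective v≢root w≢root e

  nonSource⇒sharedPrey : ∀ {z} → HasPredator D z → ∃[ v ] Σ (v ≢ root v) λ v≢root → sharedPrey v≢root ≡ z
  nonSource⇒sharedPrey {z} hz with injective⇒surjective ≤-refl encode-injective z
  ... | v , e with v ≟ root v
  ...   | yes _ = ⊥-elim (source-¬predator (label v) (subst (HasPredator D) (sym e) hz))
  ...   | no v≢root = v , v≢root , e

  twoStepPredators : ∀ {z} → HasPredator D z → ∃[ a ] ∃[ b ] (a ≢ b × Walk D m a z × Walk D m b z)
  twoStepPredators hz with nonSource⇒sharedPrey hz
  ... | v , v≢root , refl = v , parent v , ≢parent v≢root , sharedPrey-walks v≢root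

  stepPredators-determine-prey : ∀ {a b z z′} → a ≢ b → HasPredator D z → HasPredator D z′ →
                                 Walk D m a z → Walk D m b z → Walk D m a z′ → Walk D m b z′ → z ≡ z′
  stepPredators-determine-prey a≢b hz hz′ a⇝z b⇝z a⇝z′ b⇝z′
    with nonSource⇒sharedPrey hz | nonSource⇒sharedPrey hz′
  ... | v , v≢root , refl | v′ , v′≢root , refl = sharedPrey-cong (samePair
      (triangleFree⇒samePair triangleFree (≢parent v≢root) a≢b
        (proj₁ (sharedPrey-walks v≢root)) (proj₂ (sharedPrey-walks v≢root)) a⇝z b⇝z)
      (triangleFree⇒samePair triangleFree (≢parent v′≢root) a≢b
        (proj₁ (sharedPrey-walks v′≢root)) (proj₂ (sharedPrey-walks v′≢root)) a⇝z′ b⇝z′))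
    where
    sharedPrey-cong : v ≡ v′ → sharedPrey v≢root ≡ sharedPrey v′≢root
    sharedPrey-cong refl = refl

    samePair : ∀ {a b} → (v ≡ a × parent v ≡ b) ⊎ (v ≡ b × parent v ≡ a) →
               (v′ ≡ a × parent v′ ≡ b) ⊎ (v′ ≡ b × parent v′ ≡ a) → v ≡ v′
    samePair (inj₁ (v≡a , _)) (inj₁ (v′≡a , _)) = trans v≡a (sym v′≡a)
    samePair (inj₂ (v≡b , _)) (inj₂ (v′≡b , _)) = trans v≡b (sym v′≡b)
    samePair (inj₁ (v≡a , pv≡b)) (inj₂ (v′≡b , pv′≡a)) =
      ⊥-elim (parent-acyclic v≢root v′≢root (trans pv≡b (sym v′≡b)) (trans pv′≡a (sym v≡a)))
    samePair (inj₂ (v≡b , pv≡a)) (inj₁ (v′≡a , pv′≡b)) =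
      ⊥-elim (parent-acyclic v≢root v′≢root (trans pv≡a (sym v′≡a)) (trans pv′≡b (sym v≡b)))

  predators-≤2 : ∀ {a b c y} → a ≢ b → a ≢ c → Arc D a y → Arc D b y → Arc D c y → b ≡ c
  predators-≤2 {y = y} a≢b a≢c a→y b→y c→y with walkFrom outdeg (suc m′) y
  ... | _ , y⇝ = triangleFree⇒≤2-predators triangleFree a≢b a≢c (step a→y y⇝) (step b→y y⇝) (step c→y y⇝)

  nonSourcePredator : ∀ {y} → HasPredator D y → ∃[ u ] (Arc D u y × HasPredator D u)
  nonSourcePredator hy with twoStepPredators hy
  ... | a , _ , _ , a⇝y , _ with unsnoc a⇝y
  ...   | u , a⇝u , u→y = u , u→y , walk⇒predator a⇝u

  otherPredator : ∀ {x y₁ y₂} → y₁ ≢ y₂ → Arc D x y₁ → Arc D x y₂ →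
                  ∃[ w ] (Arc D w y₁ × w ≢ x × HasPredator D w)
  otherPredator {x} y₁≢y₂ x→y₁ x→y₂ with twoStepPredators (x , x→y₁)
  ... | a , b , a≢b , a⇝y₁ , b⇝y₁ with unsnoc a⇝y₁ | unsnoc b⇝y₁
  ...   | u , a⇝u , u→y₁ | u′ , b⇝u′ , u′→y₁ with u ≟ x | u′ ≟ x
  ...     | no u≢x | _ = u , u→y₁ , u≢x , walk⇒predator a⇝u
  ...     | yes _ | no u′≢x = u′ , u′→y₁ , u′≢x , walk⇒predator b⇝u′
  ...     | yes refl | yes refl = ⊥-elim (y₁≢y₂ (stepPredators-determine-prey a≢b (x , x→y₁) (x , x→y₂)
              a⇝y₁ b⇝y₁ (a⇝u ▷ x→y₂) (b⇝u′ ▷ x→y₂)))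

  sharedPredators⇒samePrey : ∀ {x x′ y₁ y₂} → x ≢ x′ → Arc D x y₁ → Arc D x′ y₁ →
                             Arc D x y₂ → Arc D x′ y₂ → y₁ ≡ y₂
  sharedPredators⇒samePrey {x} {x′} {y₁} {y₂} x≢x′ x→y₁ x′→y₁ x→y₂ x′→y₂ with twoStepPredators (x , x→y₁)
  ... | a , b , a≢b , a⇝y₁ , b⇝y₁ with unsnoc a⇝y₁ | unsnoc b⇝y₁
  ...   | u , a⇝u , u→y₁ | u′ , b⇝u′ , u′→y₁ =
    stepPredators-determine-prey a≢b (x , x→y₁) (x , x→y₂) a⇝y₁ b⇝y₁ (a⇝u ▷ toY₂ u→y₁) (b⇝u′ ▷ toY₂ u′→y₁)
    where
    toY₂ : ∀ {c} → Arc D c y₁ → Arc D c y₂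
    toY₂ {c} c→y₁ with c ≟ x
    ... | yes refl = x→y₂
    ... | no c≢x = subst (λ t → Arc D t y₂) (predators-≤2 x≢x′ (c≢x ∘ sym) x→y₁ x′→y₁ c→y₁) x′→y₂

  Preferred : Fin n → Fin n → Set
  Preferred y x = Arc D x y × HasPredator D x ×
                  (∀ {u} → Arc D u y → HasPredator D u → u ≡ x ⊎ (x ≢ root x × u ≡ parent x))

  -- Take z with y ⇝ z in m − 1 steps: the non-source predators of y are m-step
  -- predators of z, hence lie in {v, parent v} where z is the shared prey of v and its parent.
  preferred-exists : ∀ {y} → HasPredator D y → ∃ (Preferred y)
  preferred-exists {y} hy with walkFrom outdeg (suc m′) y
  ... | z , y⇝z with nonSource⇒sharedPrey (predator-walk hy y⇝z)
  ...   | v , v≢root , refl = choose (arc? D v y ×-dec hasPredator? D v)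
    where
    v-or-parent : ∀ {u} → Arc D u y → u ≡ v ⊎ u ≡ parent v
    v-or-parent {u} u→y with u ≟ v
    ... | yes u≡v = inj₁ u≡v
    ... | no u≢v = inj₂ (sym (parent-unique v≢root (u≢v ∘ sym) (step u→y y⇝z)))

    isParent : ¬ (Arc D v y × HasPredator D v) → ∀ {u} → Arc D u y → HasPredator D u → u ≡ parent v
    isParent ¬v u→y hu with v-or-parent u→y
    ... | inj₁ refl = ⊥-elim (¬v (u→y , hu))
    ... | inj₂ u≡parent = u≡parent

    choose : Dec (Arc D v y × HasPredator D v) → ∃ (Preferred y)
    choose (yes (v→y , hv)) = v , v→y , hv , λ u→y _ → map₂ (v≢root ,_) (v-or-parent u→y)
    choose (no ¬v) with nonSourcePredator hy
    ... | u , u→y , hu =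
      u , u→y , hu , λ u′→y hu′ → inj₁ (trans (isParent ¬v u′→y hu′) (sym (isParent ¬v u→y hu)))

  preferred : Fin n → Fin n
  preferred y with hasPredator? D y
  ... | yes hy = proj₁ (preferred-exists hy)
  ... | no _ = y

  preferred-spec : ∀ {y} → HasPredator D y → Preferred y (preferred y)
  preferred-spec {y} hy with hasPredator? D y
  ... | yes hy′ = proj₂ (preferred-exists hy′)
  ... | no ¬hy = ⊥-elim (¬hy hy)

  preferred-arc : ∀ {y} → HasPredator D y → Arc D (preferred y) y
  preferred-arc = proj₁ ∘ preferred-spec

  preferred-predator : ∀ {y} → HasPredator D y → HasPredator D (preferred y)
  preferred-predator = proj₁ ∘ proj₂ ∘ preferred-spec

  preferred-source : ∀ {y} → ¬ HasPredator D y → preferred y ≡ y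
  preferred-source {y} ¬hy with hasPredator? D y
  ... | yes hy = ⊥-elim (¬hy hy)
  ... | no _ = refl

  otherPredator⇒parent : ∀ {y w} → HasPredator D y → Arc D w y → HasPredator D w → w ≢ preferred y →
                         preferred y ≢ root (preferred y) × w ≡ parent (preferred y)
  otherPredator⇒parent hy w→y hw w≢x with proj₂ (proj₂ (preferred-spec hy)) w→y hw
  ... | inj₁ w≡x = ⊥-elim (w≢x w≡x)
  ... | inj₂ parentCase = parentCase

  twoPrey⇒parentArc : ∀ {y y′} → HasPredator D y → y ≢ y′ → Arc D (preferred y) y′ →
                      preferred y ≢ root (preferred y) × Arc D (parent (preferred y)) y
  twoPrey⇒parentArc hy y≢y′ x→y′ with otherPredator y≢y′ (preferred-arc hy) x→y′
  ... | w , w→y , w≢x , hw with otherPredator⇒parent hy w→y hw w≢x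
  ...   | x≢root , refl = x≢root , w→y

  preferred-injective-nonSources : ∀ {y₁ y₂} → HasPredator D y₁ → HasPredator D y₂ →
                                   preferred y₁ ≡ preferred y₂ → y₁ ≡ y₂
  preferred-injective-nonSources {y₁} {y₂} h₁ h₂ e with y₁ ≟ y₂
  ... | yes y₁≡y₂ = y₁≡y₂
  ... | no y₁≢y₂ = sharedPredators⇒samePrey (≢parent (proj₁ parent₁)) x→y₁ (proj₂ parent₁) x→y₂ p→y₂
    where
    x→y₁ = preferred-arc h₁
    x→y₂ = subst (λ t → Arc D t y₂) (sym e) (preferred-arc h₂)
    parent₁ = twoPrey⇒parentArc h₁ y₁≢y₂ x→y₂
    parent₂ = twoPrey⇒parentArc h₂ (y₁≢y₂ ∘ sym) (subst (λ t → Arc D t y₁) e x→y₁)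
    p→y₂ = subst (λ t → Arc D (parent t) y₂) (sym e) (proj₂ parent₂)

  preferred-injective : Injective _≡_ _≡_ preferred
  preferred-injective {y₁} {y₂} e = byKinds (hasPredator? D y₁) (hasPredator? D y₂)
    where
    byKinds : Dec (HasPredator D y₁) → Dec (HasPredator D y₂) → y₁ ≡ y₂
    byKinds (no ¬h₁) (no ¬h₂) = trans (sym (preferred-source ¬h₁)) (trans e (preferred-source ¬h₂))
    byKinds (no ¬h₁) (yes h₂) =
      ⊥-elim (¬h₁ (subst (HasPredator D) (trans (sym e) (preferred-source ¬h₁)) (preferred-predator h₂)))
    byKinds (yes h₁) (no ¬h₂) =
      ⊥-elim (¬h₂ (subst (HasPredator D) (trans e (preferred-source ¬h₂)) (preferred-predator h₁)))
    byKinds (yes h₁) (yes h₂) = preferred-injective-nonSources h₁ h₂ e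

  preferred-onto : ∀ {x} → HasPredator D x → ∃[ y ] (HasPredator D y × preferred y ≡ x)
  preferred-onto {x} hx with injective⇒surjective ≤-refl preferred-injective x
  ... | y , py≡x = y , byKind (hasPredator? D y) , py≡x
    where
    byKind : Dec (HasPredator D y) → HasPredator D y
    byKind (yes hy) = hy
    byKind (no ¬hy) = ⊥-elim (¬hy (subst (HasPredator D) (trans (sym py≡x) (preferred-source ¬hy)) hx))

  TwoPrey : Fin n → Set
  TwoPrey x = HasPredator D x × ∃[ y₁ ] ∃[ y₂ ] (y₁ ≢ y₂ × Arc D x y₁ × Arc D x y₂)

  otherPredator⇒parentTwoPrey : ∀ {y w} → HasPredator D y → Arc D w y → HasPredator D w → w ≢ preferred y →
                                TwoPrey (parent (preferred y)) ×
                                depth (parent (preferred y)) < depth (preferred y)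
  otherPredator⇒parentTwoPrey {y} hy w→y hw w≢x with otherPredator⇒parent hy w→y hw w≢x
  ... | x≢root , refl with preferred-onto hw
  ...   | y′ , hy′ , py′≡w = (hw , y , y′ , y≢y′ , w→y , w→y′) , depth-parent x≢root
    where
    w→y′ = subst (λ t → Arc D t y′) py′≡w (preferred-arc hy′)

    y≢y′ : y ≢ y′
    y≢y′ refl = ≢parent x≢root py′≡w

  twoPrey-descent : ∀ {x} → TwoPrey x → ∃[ o ] (TwoPrey o × depth o < depth x)
  twoPrey-descent (hx , y₁ , y₂ , y₁≢y₂ , x→y₁ , x→y₂) with preferred-onto hx
  ... | y , hy , refl with anotherPrey {D = D} y₁≢y₂ x→y₁ x→y₂ y
  ...   | y′ , y≢y′ , x→y′ with otherPredator y≢y′ (preferred-arc hy) x→y′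
  ...     | w , w→y , w≢x , hw = parent (preferred y) , otherPredator⇒parentTwoPrey hy w→y hw w≢x

  ¬twoPrey-acc : ∀ {x} → Acc _<_ (depth x) → ¬ TwoPrey x
  ¬twoPrey-acc (acc smaller) twoPrey with twoPrey-descent twoPrey
  ... | o , twoPreyO , o<x = ¬twoPrey-acc (smaller o<x) twoPreyO

  ¬twoPrey : ∀ {x} → ¬ TwoPrey x
  ¬twoPrey = ¬twoPrey-acc (<-wellFounded _)

  nonSourcePredator-unique : ∀ {u u′ y} → Arc D u y → Arc D u′ y → HasPredator D u → HasPredator D u′ → u ≡ u′
  nonSourcePredator-unique {u} {u′} {y} u→y u′→y hu hu′ with u ≟ u′
  ... | yes u≡u′ = u≡u′
  ... | no u≢u′ with u ≟ preferred y
  ...   | yes refl = ⊥-elim (¬twoPrey (proj₁ (otherPredator⇒parentTwoPrey (u , u→y) u′→y hu′ (u≢u′ ∘ sym))))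
  ...   | no u≢x = ⊥-elim (¬twoPrey (proj₁ (otherPredator⇒parentTwoPrey (u , u→y) u→y hu u≢x)))

  uniquePrey : ∀ {x} → HasPredator D x → ∃[ y ] (Arc D x y × (∀ {z} → Arc D x z → z ≡ y))
  uniquePrey {x} hx with outdeg x
  ... | y , x→y = y , x→y , onlyPrey
    where
    onlyPrey : ∀ {z} → Arc D x z → z ≡ y
    onlyPrey {z} x→z with z ≟ y
    ... | yes z≡y = z≡y
    ... | no z≢y = ⊥-elim (¬twoPrey (hx , z , y , z≢y , x→z , x→y))

  longerWalk⇒predator : ∀ j {a y′ y} → HasPredator D y′ → Walk D j y′ y → Walk D (suc j) a y → Arc D a y′
  longerWalk⇒predator zero _ here (step a→y here) = a→y
  longerWalk⇒predator (suc j) hy′ y′⇝y a⇝y with unsnoc y′⇝y | unsnoc a⇝y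
  ... | u , y′⇝u , u→y | u′ , a⇝u′ , u′→y
    with nonSourcePredator-unique u→y u′→y (predator-walk hy′ y′⇝u) (walk⇒predator a⇝u′)
  ...   | refl = longerWalk⇒predator j hy′ y′⇝u a⇝u′

  -- The two m-step predators of a vertex m − 1 steps after x are both predators of x.
  sourcePredator : ∀ {x} → HasPredator D x → ∃[ s ] (Arc D s x × ¬ HasPredator D s)
  sourcePredator {x} hx with walkFrom outdeg (suc m′) x
  ... | y , x⇝y with twoStepPredators (predator-walk hx x⇝y)
  ...   | a , b , a≢b , a⇝y , b⇝y = pick (hasPredator? D a) (hasPredator? D b)
    where
    a→x = longerWalk⇒predator (suc m′) hx x⇝y a⇝y
    b→x = longerWalk⇒predator (suc m′) hx x⇝y b⇝y

    pick : Dec (HasPredator D a) → Dec (HasPredator D b) → ∃[ s ] (Arc D s x × ¬ HasPredator D s)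
    pick (no ¬ha) _ = a , a→x , ¬ha
    pick (yes _) (no ¬hb) = b , b→x , ¬hb
    pick (yes ha) (yes hb) = ⊥-elim (a≢b (nonSourcePredator-unique a→x b→x ha hb))

  predatorPair : ∀ {x} → HasPredator D x → PredatorPair D x
  predatorPair {x} hx with sourcePredator hx | nonSourcePredator hx
  ... | s , s→x , ¬hs | u , u→x , hu = record
    { src = s ; nonSrc = u ; src→x = s→x ; nonSrc→x = u→x ; onlyPredators = only
    ; src-¬predator = ¬hs ; nonSrc-predator = hu }
    where
    s≢u : s ≢ u
    s≢u s≡u = ¬hs (subst (HasPredator D) (sym s≡u) hu)

    only : ∀ {c} → Arc D c x → c ≡ s ⊎ c ≡ u
    only {c} c→x with c ≟ s
    ... | yes c≡s = inj₁ c≡s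
    ... | no c≢s = inj₂ (sym (predators-≤2 s≢u (c≢s ∘ sym) s→x u→x c→x))

  globalS₃ : GlobalS₃ D
  globalS₃ = record { uniquePrey = uniquePrey ; predatorPair = predatorPair }

lemma3p6 : ∀ {n} (D : Digraph n) → OutdegPos D → EachWeakCompHasSource D →
    (∀ (m : ℕ) → 2 ≤ m →
       (AllWeakCompsStarGen D ⇔ (TriangleFree (Cm m D) × NumComponents (Cm m D) (numSources D))))
    × (AllWeakCompsStarGen D → TriangleFree (Cm 1 D) × NumComponents (Cm 1 D) (numSources D))
lemma3p6 D outdeg hasSource = characterization , competition zero
  where
  competition : ∀ m′ → AllWeakCompsStarGen D →
                TriangleFree (Cm (suc m′) D) × NumComponents (Cm (suc m′) D) (numSources D)
  competition m′ starGen = triangleFree , numComponents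
    where open GlobalS₃⇒StepCompetition outdeg (allWeakCompsStarGen⇒globalS₃ starGen) m′

  characterization : ∀ m → 2 ≤ m →
    AllWeakCompsStarGen D ⇔ (TriangleFree (Cm m D) × NumComponents (Cm m D) (numSources D))
  characterization (suc zero) (s≤s ())
  characterization (suc (suc m′)) _ = mk⇔ (competition (suc m′)) λ (triangleFree , components) →
    globalS₃⇒allWeakCompsStarGen (StepCompetition⇒GlobalS₃.globalS₃ outdeg m′ triangleFree components) hasSource
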